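{- Let $G$ be a graph or digraph. If a dapasting $P$ of a pair of dacards of $G$ as members of $\mathrm{Dadeck}(G)$ is a dapasting in each of two da-hypomorphs $H_1$ and $H_2$ of $G$, then $H_1\cong H_2$.
   Context: Digraphs are finite, without loops or multiple arcs; a graph is regarded as a digraph in which every edge is a pair of opposite arcs. For a vertex $x$ of a digraph $D$, $\mathrm{dt}_D(x)=(a,b,c)$ where $a,b,c$ count vertices $w$ such that respectively only $xw$, only $wx$, both $xw,wx$ are arcs. A dacard of $D$ is a pair $(D-x,\mathrm{dt}_D(x))$, with $D-x$ up to isomorphism; $\mathrm{Dadeck}(D)$ is the multiset of dacards; digraphs with the same dadeck are da-hypomorphs. A dapasting of dacards $(A,\alpha),(B,\beta)$ of $G$ (obtained by deleting distinct vertices) as members of $\mathrm{Dadeck}(G)$ is a digraph $P$ with two distinct non-adjacent vertices $u,v$, labeled $(e,\alpha)$ and $(e,\beta)$, such that $P-u\cong A$, $P-v\cong B$ and there is $Y\in\{P,P+uv,P+vu,P+uv+vu\}$ ($P+xy$ = $P$ with arc $xy$ added) with $\mathrm{dt}_Y(u)=\alpha$, $\mathrm{dt}_Y(v)=\beta$ and $Y$ da-hypomorphic to $G$; every digraph isomorphic to such $Y$ is a completion of $P$. $P$ is a dapasting in a digraph $J$ if $J$ is a completion of $P$. -}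

module Defs where

open import Data.Nat using (ℕ; zero; suc; _+_)
open import Data.Bool using (Bool; true; false; _∧_; _∨_; not; if_then_else_)
open import Data.Fin using (Fin; zero; suc; punchIn; _≟_)
open import Data.Fin.Properties using (punchInᵢ≢i; punchIn-injective)
open import Data.Product using (Σ; _×_; _,_; ∃)
open import Data.Unit using (⊤)
open import Data.Empty using (⊥)
open import Function.Bundles using (_↔_; Inverse)
open import Relation.Nullary using (¬_; yes; no)
open import Relation.Nullary.Decidable using (⌊_⌋)
open import Relation.Binary.PropositionalEquality using (_≡_; refl; _≢_)

-- A (finite, loopless) digraph on the vertex set Fin n.  Multiple arcs are
-- impossible since adjacency is a Boolean relation.  A graph is a digraph
-- with a symmetric adjacency relation.
record Digraph (n : ℕ) : Set where
  field
    adj    : Fin n → Fin n → Bool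
    irrefl : ∀ i → adj i i ≡ false
open Digraph public

count : ∀ {n} → (Fin n → Bool) → ℕ
count {zero}  f = 0
count {suc n} f = (if f zero then 1 else 0) + count (λ i → f (suc i))

dt : ∀ {n} → Digraph n → Fin n → ℕ × ℕ × ℕ
dt D x =
  count (λ w → adj D x w ∧ not (adj D w x)) ,
  count (λ w → not (adj D x w) ∧ adj D w x) ,
  count (λ w → adj D x w ∧ adj D w x)

del : ∀ {n} → Digraph (suc n) → Fin (suc n) → Digraph n
del D x = record
  { adj = λ i j → adj D (punchIn x i) (punchIn x j)
  ; irrefl = λ i → irrefl D (punchIn x i) }

Iso : ∀ {m n} → Digraph m → Digraph n → Set
Iso {m} {n} D E =
  Σ (Fin m ↔ Fin n) λ f →
    ∀ i j → adj D i j ≡ adj E (Inverse.to f i) (Inverse.to f j)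

-- da-hypomorphism: equality of dadecks as multisets of
-- (isomorphism class of card , degree triple)
DaHypo : ∀ {m n} → Digraph m → Digraph n → Set
DaHypo {zero}  {zero}  D E = ⊤
DaHypo {zero}  {suc n} D E = ⊥
DaHypo {suc m} {zero}  D E = ⊥
DaHypo {suc m} {suc n} D E =
  Σ (Fin (suc m) ↔ Fin (suc n)) λ σ →
    ∀ x → Iso (del D x) (del E (Inverse.to σ x))
          × (dt D x ≡ dt E (Inverse.to σ x))

addArc : ∀ {n} → Digraph n → Fin n → Fin n → Digraph n
addArc {n} D u v = record { adj = a ; irrefl = ir }
  where
  a : Fin n → Fin n → Bool
  a i j = adj D i j ∨ (not ⌊ i ≟ j ⌋ ∧ ⌊ i ≟ u ⌋ ∧ ⌊ j ≟ v ⌋)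
  ir : ∀ i → a i i ≡ false
  ir i with adj D i i | irrefl D i | i ≟ i
  ... | false | refl | yes _ = refl
  ir i | false | refl | no ¬p with ¬p refl
  ... | ()

data Choice : Set where
  none uv vu both : Choice

applyChoice : ∀ {n} → Choice → Digraph n → Fin n → Fin n → Digraph n
applyChoice none P u v = P
applyChoice uv   P u v = addArc P u v
applyChoice vu   P u v = addArc P v u
applyChoice both P u v = addArc (addArc P u v) v u

ValidCompletionOf : ∀ {n} (G : Digraph (suc n)) (P : Digraph (suc n))
  (u v : Fin (suc n)) (α β : ℕ × ℕ × ℕ) (c : Choice) → Set
ValidCompletionOf G P u v α β c =
  let Y = applyChoice c P u v in
  (dt Y u ≡ α) × (dt Y v ≡ β) × DaHypo Y G

-- P (with distinguished vertices u, v) is a dapasting of the dacards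
-- (G - x , dt_G x) and (G - y , dt_G y) of G, x ≠ y
IsDapasting : ∀ {n} (G P : Digraph (suc n)) (x y u v : Fin (suc n)) → Set
IsDapasting G P x y u v =
  (x ≢ y) × (u ≢ v) × (adj P u v ≡ false) × (adj P v u ≡ false)
  × Iso (del P u) (del G x) × Iso (del P v) (del G y)
  × ∃ (ValidCompletionOf G P u v (dt G x) (dt G y))

-- H is a completion of the dapasting P (i.e. P is a dapasting in H)
IsCompletion : ∀ {n k} (G P : Digraph (suc n)) (x y u v : Fin (suc n))
  (H : Digraph k) → Set
IsCompletion G P x y u v H =
  Σ Choice λ c → ValidCompletionOf G P u v (dt G x) (dt G y) c
                 × Iso H (applyChoice c P u v)

{-# OPTIONS --safe #-}
module Submission where

-- All completions of P are P plus some of the arcs uv, vu, and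
-- they agree with P everywhere except on the pair {u, v}.  Hence the degree
-- triple of u in a completion is that of u in P - v, shifted by (0,0,0),
-- (1,0,0), (0,1,0) or (0,0,1) according to which u–v connection was chosen.  A completion
-- must give u the triple dt_G(x), so this choice, and with it the completion up
-- to isomorphism, is unique.

open import Defs
open import Data.Nat using (ℕ; suc; zero; _+_)
open import Data.Nat.Properties using (+-cancelʳ-≡; +-comm; +-assoc)
open import Data.Fin using (Fin; zero; suc; punchIn; _≟_)
open import Data.Fin.Properties using (punchInᵢ≢i)
open import Data.Bool using (Bool; true; false; _∧_; _∨_; not; if_then_else_)
open import Data.Bool.Properties using (∨-identityʳ; ∨-zeroʳ; ∧-zeroʳ)
open import Data.Product using (_×_; _,_)
open import Data.Product.Properties using (,-injectiveˡ; ,-injectiveʳ)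
open import Data.Sum using (_⊎_; inj₁; inj₂)
open import Data.Empty using (⊥-elim)
open import Function using (_∘_)
open import Function.Bundles using (Inverse)
open import Function.Properties.Inverse using (↔-sym; ↔-trans)
open import Relation.Nullary using (yes; no)
open import Relation.Binary.PropositionalEquality

Iso-sym : ∀ {m n} {D : Digraph m} {E : Digraph n} → Iso D E → Iso E D
Iso-sym {E = E} (f , f-adj) = ↔-sym f , λ i j →
  trans (cong₂ (adj E) (sym (Inverse.strictlyInverseˡ f i)) (sym (Inverse.strictlyInverseˡ f j)))
        (sym (f-adj (Inverse.from f i) (Inverse.from f j)))

Iso-trans : ∀ {m n k} {D : Digraph m} {E : Digraph n} {F : Digraph k} →
  Iso D E → Iso E F → Iso D F
Iso-trans (f , f-adj) (g , g-adj) = ↔-trans f g , λ i j → trans (f-adj i j) (g-adj _ _)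

Triple : Set
Triple = ℕ × ℕ × ℕ

_⊕_ : Triple → Triple → Triple
(a , b , c) ⊕ (a′ , b′ , c′) = a + a′ , b + b′ , c + c′

⊕-cancelʳ : ∀ s t r → s ⊕ r ≡ t ⊕ r → s ≡ t
⊕-cancelʳ (a , b , c) (a′ , b′ , c′) (p , q , r) e =
  cong₂ _,_ (+-cancelʳ-≡ p a a′ (,-injectiveˡ e))
    (cong₂ _,_ (+-cancelʳ-≡ q b b′ (,-injectiveˡ (,-injectiveʳ e)))
               (+-cancelʳ-≡ r c c′ (,-injectiveʳ (,-injectiveʳ e))))

-- dt D x is definitionally typeCounts (adj D x) (λ w → adj D w x).
typeCounts : ∀ {n} → (Fin n → Bool) → (Fin n → Bool) → Triple
typeCounts out in′ =
  count (λ w → out w ∧ not (in′ w)) ,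
  count (λ w → not (out w) ∧ in′ w) ,
  count (λ w → out w ∧ in′ w)

indicator : Bool → ℕ
indicator b = if b then 1 else 0

arcType : Bool → Bool → Triple
arcType o i = indicator (o ∧ not i) , indicator (not o ∧ i) , indicator (o ∧ i)

count-cong : ∀ {n} {f g : Fin n → Bool} → (∀ i → f i ≡ g i) → count f ≡ count g
count-cong {zero}  e = refl
count-cong {suc n} e = cong₂ _+_ (cong indicator (e zero)) (count-cong (e ∘ suc))

count-punchIn : ∀ {n} (f : Fin (suc n) → Bool) (v : Fin (suc n)) →
  count f ≡ indicator (f v) + count (f ∘ punchIn v)
count-punchIn f zero = refl
count-punchIn {suc n} f (suc v) = begin
  indicator (f zero) + count (f ∘ suc)
    ≡⟨ cong (indicator (f zero) +_) (count-punchIn (f ∘ suc) v) ⟩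
  indicator (f zero) + (indicator (f (suc v)) + rest)
    ≡⟨ sym (+-assoc (indicator (f zero)) _ rest) ⟩
  indicator (f zero) + indicator (f (suc v)) + rest
    ≡⟨ cong (_+ rest) (+-comm (indicator (f zero)) _) ⟩
  indicator (f (suc v)) + indicator (f zero) + rest
    ≡⟨ +-assoc (indicator (f (suc v))) _ rest ⟩
  indicator (f (suc v)) + count (f ∘ punchIn (suc v)) ∎
  where
  open ≡-Reasoning
  rest : ℕ
  rest = count (f ∘ suc ∘ punchIn v)

typeCounts-cong : ∀ {n} {o o′ i i′ : Fin n → Bool} →
  (∀ w → o w ≡ o′ w) → (∀ w → i w ≡ i′ w) → typeCounts o i ≡ typeCounts o′ i′
typeCounts-cong eo ei =
  cong₂ _,_ (count-cong λ w → cong₂ (λ a b → a ∧ not b) (eo w) (ei w))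
    (cong₂ _,_ (count-cong λ w → cong₂ (λ a b → not a ∧ b) (eo w) (ei w))
               (count-cong λ w → cong₂ _∧_ (eo w) (ei w)))

typeCounts-punchIn : ∀ {n} (o i : Fin (suc n) → Bool) (v : Fin (suc n)) →
  typeCounts o i ≡ arcType (o v) (i v) ⊕ typeCounts (o ∘ punchIn v) (i ∘ punchIn v)
typeCounts-punchIn o i v =
  cong₂ _,_ (count-punchIn (λ w → o w ∧ not (i w)) v)
    (cong₂ _,_ (count-punchIn (λ w → not (o w) ∧ i w) v) (count-punchIn (λ w → o w ∧ i w) v))

addArc-adj-other : ∀ {n} (D : Digraph n) (a b i j : Fin n) → (i ≢ a ⊎ j ≢ b) →
  adj (addArc D a b) i j ≡ adj D i j
addArc-adj-other D a b i j i≢a⊎j≢b with i ≟ a | j ≟ b | i≢a⊎j≢b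
... | yes i≡a | yes _   | inj₁ i≢a = ⊥-elim (i≢a i≡a)
... | yes _   | yes j≡b | inj₂ j≢b = ⊥-elim (j≢b j≡b)
... | yes _   | no _    | _ = trans (cong (adj D i j ∨_) (∧-zeroʳ _)) (∨-identityʳ _)
... | no _    | _       | _ = trans (cong (adj D i j ∨_) (∧-zeroʳ _)) (∨-identityʳ _)

addArc-adj-new : ∀ {n} (D : Digraph n) (a b : Fin n) → a ≢ b → adj (addArc D a b) a b ≡ true
addArc-adj-new D a b a≢b with a ≟ b | a ≟ a | b ≟ b
... | yes a≡b | _     | _     = ⊥-elim (a≢b a≡b)
... | no _    | yes _ | yes _ = ∨-zeroʳ _
... | no _    | no ¬p | _     = ⊥-elim (¬p refl)
... | no _    | _     | no ¬p = ⊥-elim (¬p refl)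

hasUV hasVU : Choice → Bool
hasUV none = false
hasUV uv   = true
hasUV vu   = false
hasUV both = true
hasVU none = false
hasVU uv   = false
hasVU vu   = true
hasVU both = true

choiceType : Choice → Triple
choiceType c = arcType (hasUV c) (hasVU c)

-- The four choices have types (0,0,0), (1,0,0), (0,1,0), (0,0,1).
choiceOfType : Triple → Choice
choiceOfType (1 , _ , _) = uv
choiceOfType (_ , 1 , _) = vu
choiceOfType (_ , _ , 1) = both
choiceOfType _           = none

choiceOfType-choiceType : ∀ c → choiceOfType (choiceType c) ≡ c
choiceOfType-choiceType none = refl
choiceOfType-choiceType uv   = refl
choiceOfType-choiceType vu   = refl
choiceOfType-choiceType both = refl

choiceType-injective : ∀ c₁ c₂ → choiceType c₁ ≡ choiceType c₂ → c₁ ≡ c₂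
choiceType-injective c₁ c₂ e = begin
  c₁                            ≡⟨ sym (choiceOfType-choiceType c₁) ⟩
  choiceOfType (choiceType c₁)  ≡⟨ cong choiceOfType e ⟩
  choiceOfType (choiceType c₂)  ≡⟨ choiceOfType-choiceType c₂ ⟩
  c₂                            ∎
  where open ≡-Reasoning

module _ {n : ℕ} (P : Digraph (suc n)) {u v : Fin (suc n)} (u≢v : u ≢ v)
         (¬uv : adj P u v ≡ false) (¬vu : adj P v u ≡ false) where

  private
    v≢u : v ≢ u
    v≢u = u≢v ∘ sym

  applyChoice-adj-u : ∀ c w → w ≢ v → adj (applyChoice c P u v) u w ≡ adj P u w
  applyChoice-adj-u none w w≢v = refl
  applyChoice-adj-u uv   w w≢v = addArc-adj-other P u v u w (inj₂ w≢v)
  applyChoice-adj-u vu   w w≢v = addArc-adj-other P v u u w (inj₁ u≢v)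
  applyChoice-adj-u both w w≢v =
    trans (addArc-adj-other (addArc P u v) v u u w (inj₁ u≢v)) (addArc-adj-other P u v u w (inj₂ w≢v))

  applyChoice-adj-to-u : ∀ c w → w ≢ v → adj (applyChoice c P u v) w u ≡ adj P w u
  applyChoice-adj-to-u none w w≢v = refl
  applyChoice-adj-to-u uv   w w≢v = addArc-adj-other P u v w u (inj₂ u≢v)
  applyChoice-adj-to-u vu   w w≢v = addArc-adj-other P v u w u (inj₁ w≢v)
  applyChoice-adj-to-u both w w≢v =
    trans (addArc-adj-other (addArc P u v) v u w u (inj₁ w≢v)) (addArc-adj-other P u v w u (inj₂ u≢v))

  applyChoice-adj-uv : ∀ c → adj (applyChoice c P u v) u v ≡ hasUV c
  applyChoice-adj-uv none = ¬uv
  applyChoice-adj-uv uv   = addArc-adj-new P u v u≢v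
  applyChoice-adj-uv vu   = trans (addArc-adj-other P v u u v (inj₁ u≢v)) ¬uv
  applyChoice-adj-uv both =
    trans (addArc-adj-other (addArc P u v) v u u v (inj₁ u≢v)) (addArc-adj-new P u v u≢v)

  applyChoice-adj-vu : ∀ c → adj (applyChoice c P u v) v u ≡ hasVU c
  applyChoice-adj-vu none = ¬vu
  applyChoice-adj-vu uv   = trans (addArc-adj-other P u v v u (inj₁ v≢u)) ¬vu
  applyChoice-adj-vu vu   = addArc-adj-new P v u v≢u
  applyChoice-adj-vu both = addArc-adj-new (addArc P u v) v u v≢u

  dt-applyChoice : ∀ c → dt (applyChoice c P u v) u ≡
    choiceType c ⊕ typeCounts (adj P u ∘ punchIn v) (λ w → adj P (punchIn v w) u)
  dt-applyChoice c = trans (typeCounts-punchIn (adj Y u) (λ w → adj Y w u) v)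
    (cong₂ _⊕_ (cong₂ arcType (applyChoice-adj-uv c) (applyChoice-adj-vu c))
      (typeCounts-cong (λ w → applyChoice-adj-u c _ (punchInᵢ≢i v w))
                       (λ w → applyChoice-adj-to-u c _ (punchInᵢ≢i v w))))
    where
    Y : Digraph (suc n)
    Y = applyChoice c P u v

  applyChoice-unique-by-dt : ∀ c₁ c₂ →
    dt (applyChoice c₁ P u v) u ≡ dt (applyChoice c₂ P u v) u → c₁ ≡ c₂
  applyChoice-unique-by-dt c₁ c₂ e = choiceType-injective c₁ c₂
    (⊕-cancelʳ _ _ _ (trans (sym (dt-applyChoice c₁)) (trans e (dt-applyChoice c₂))))

corollary5p4 : (n : ℕ) (G P : Digraph (suc n)) (x y u v : Fin (suc n))
    → IsDapasting G P x y u v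
    → {k₁ k₂ : ℕ} (H₁ : Digraph k₁) (H₂ : Digraph k₂)
    → DaHypo H₁ G → DaHypo H₂ G
    → IsCompletion G P x y u v H₁ → IsCompletion G P x y u v H₂
    → Iso H₁ H₂
corollary5p4 n G P x y u v (_ , u≢v , ¬uv , ¬vu , _) H₁ H₂ _ _
  (c₁ , (dt₁ , _) , H₁≅Y₁) (c₂ , (dt₂ , _) , H₂≅Y₂)
  with applyChoice-unique-by-dt P u≢v ¬uv ¬vu c₁ c₂ (trans dt₁ (sym dt₂))
... | refl = Iso-trans {D = H₁} {E = Y} {F = H₂} H₁≅Y₁ (Iso-sym {D = H₂} {E = Y} H₂≅Y₂)
  where
  Y : Digraph (suc n)
  Y = applyChoice c₁ P u v
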